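{- Let $(a,b,c)$ be a primitive Eisenstein triple, and let $m,n$ be the integers parameterizing either $(a,b,c)$ or $(b-a,b,c)$ in the sense that this triple equals $(m(2n-m),\, n(2m-n),\, m^2-mn+n^2)$, where $m,n>0$, $\gcd(m,n)=1$, $1 \leq \frac{m}{n} \leq 2$, and $3 \nmid (m+n)$. Let $\theta$ be the angle with $\cos\theta = \frac{|b-2a|}{2c} = \frac{|b-2(b-a)|}{2c}$. Define \[ \Gamma_\theta = \begin{bmatrix} 1 & -\frac{1}{2} \\ 0 & \frac{\sqrt{3}}{2} \end{bmatrix} \begin{bmatrix} m & m-n \\ m-n & m \end{bmatrix} \mathbb{Z}^2 = \frac{1}{2} \begin{bmatrix} m+n&m-2n \\ (m-n)\sqrt{3}&m\sqrt{3} \end{bmatrix} \mathbb{Z}^2. \] Then $\Gamma_{\theta}$ is a well-rounded sublattice of $\Lambda_h$, its angle is $\theta$, and the similarity class $C_h(\theta)$ of well-rounded sublattices of $\Lambda_h$ with angle $\theta$ equals $\{\Omega \text{ well-rounded sublattice of } \Lambda_h : \Omega \sim \Gamma_\theta\}$. Moreover, \[ |\Gamma_\theta| = c, \quad \det \Gamma_\theta = b\frac{\sqrt{3}}{2}, \quad |\Lambda_h : \Gamma_{\theta}| = b. \]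
   Context: $\Lambda_h = \begin{bmatrix} 1&-\frac{1}{2} \\ 0&\frac{\sqrt{3}}{2} \end{bmatrix} \mathbb{Z}^2$ is the hexagonal lattice. For a lattice $\Gamma\subset\mathbb{R}^2$, $|\Gamma|$ denotes its minimum $\min\{\|y\|^2 : y\in\Gamma\setminus\{0\}\}$ and $\det(\Gamma)=|\det A|$ for a basis matrix $A$. A planar lattice is well-rounded (WR) if it has a basis of minimal vectors; such a minimal basis can be chosen with angle between the vectors in $[\pi/3,\pi/2]$, and this angle $\theta(\Gamma)$ is an invariant. Two lattices are similar ($\sim$) if one is obtained from the other by a nonzero real scaling and a real orthogonal matrix; two WR lattices are similar iff they have the same angle. An Eisenstein triple is $(a,b,c)\in\mathbb{Z}^3_{\geq 0}\setminus\{0\}$ with $a^2-ab+b^2=c^2$; it is primitive if $a\leq b$ and $\gcd(a,b,c)=1$. For every primitive Eisenstein triple $(a,b,c)$, $(b-a,b,c)$ is again one, and exactly one of the two is parameterized by integers $m,n$ as in the claim. -}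

module Defs where

open import Data.Nat as ℕ using (ℕ)
import Data.Nat.GCD as ℕG
open import Data.Integer using (ℤ; +_; _+_; _-_; _*_; _≤_; _<_; ∣_∣; -_)
open import Data.Integer.Divisibility using (_∣_)
import Data.Integer.GCD as ℤG
open import Data.Fin using (Fin)
open import Data.Product using (Σ; ∃; ∃-syntax; _×_; _,_)
open import Relation.Binary.PropositionalEquality using (_≡_; _≢_)
open import Relation.Nullary using (¬_)

-- Planar geometry in coordinates w.r.t. the basis of the hexagonal
-- lattice Λ_h = A ℤ², A = [[1,-1/2],[0,√3/2]].
-- A vector v = (x , y) ∈ ℤ² stands for the point A v ∈ Λ_h ⊂ ℝ².

V : Set
V = ℤ × ℤ

zeroV : V
zeroV = (+ 0 , + 0)

_⊕_ : V → V → V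
(x₁ , y₁) ⊕ (x₂ , y₂) = (x₁ + x₂ , y₁ + y₂)

_⊖_ : V → V → V
(x₁ , y₁) ⊖ (x₂ , y₂) = (x₁ - x₂ , y₁ - y₂)

_·_ : ℤ → V → V
k · (x , y) = (k * x , k * y)

-- ‖A v‖² = x² - x y + y²  (exact squared Euclidean norm)
Q : V → ℤ
Q (x , y) = x * x - x * y + y * y

-- 2⟨A v, A w⟩ = 2 x₁x₂ - x₁y₂ - x₂y₁ + 2 y₁y₂  (twice the Euclidean inner product)
B : V → V → ℤ
B (x₁ , y₁) (x₂ , y₂) = + 2 * x₁ * x₂ - x₁ * y₂ - x₂ * y₁ + + 2 * y₁ * y₂

-- Sublattices of Λ_h, given by a pair of generators (columns of an
-- integer matrix M); the lattice is A M ℤ².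

record Lat : Set where
  constructor lat
  field
    p : V
    q : V
open Lat public

-- determinant of the coordinate matrix M = [p q];
-- the Euclidean determinant of A M ℤ² is (√3/2) · ∣ detM ∣.
detM : Lat → ℤ
detM (lat (x₁ , y₁) (x₂ , y₂)) = x₁ * y₂ - x₂ * y₁

FullRank : Lat → Set
FullRank L = detM L ≢ + 0

_∈L_ : V → Lat → Set
v ∈L L = ∃[ i ] ∃[ j ] (v ≡ (i · p L) ⊕ (j · q L))

IsBasis : Lat → V → V → Set
IsBasis L u v = u ∈L L × v ∈L L × p L ∈L lat u v × q L ∈L lat u v

-- |L| = N : N is the minimum squared norm of nonzero vectors of L
IsMinimum : Lat → ℤ → Set
IsMinimum L N =
  (∃[ v ] (v ∈L L × v ≢ zeroV × Q v ≡ N)) ×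
  (∀ v → v ∈L L → v ≢ zeroV → N ≤ Q v)

MinimalBasis : Lat → V → V → Set
MinimalBasis L u v = IsBasis L u v × IsMinimum L (Q u) × Q v ≡ Q u

WellRounded : Lat → Set
WellRounded L = ∃[ u ] ∃[ v ] MinimalBasis L u v

-- The angle θ(L) of a WR lattice satisfies cos θ(L) = r / s (s > 0):
-- there is a minimal basis (u , v) whose angle lies in [π/3, π/2]
-- (i.e. 0 ≤ ⟨u,v⟩ ≤ |L|/2) and cos∠(u,v) = ⟨u,v⟩/|L| = B u v / (2 Q u) = r / s.
-- Since cos is injective on [π/3, π/2] this pins down θ(L).
AngleCos : Lat → ℤ → ℤ → Set
AngleCos L r s = ∃[ u ] ∃[ v ]
  (MinimalBasis L u v × + 0 ≤ B u v × B u v ≤ Q u ×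
   B u v * s ≡ + 2 * Q u * r)

-- Similarity Ω ∼ Γ (Ω = α U Γ, α ∈ ℝ∖0, U orthogonal), expressed through
-- Gram matrices: bases of the two lattices whose Gram matrices are
-- proportional by a positive factor l/k.
Similar : Lat → Lat → Set
Similar L L' = ∃[ u₁ ] ∃[ u₂ ] ∃[ w₁ ] ∃[ w₂ ] ∃[ k ] ∃[ l ]
  (IsBasis L u₁ u₂ × IsBasis L' w₁ w₂ × + 0 < k × + 0 < l ×
   k * B u₁ u₁ ≡ l * B w₁ w₁ ×
   k * B u₁ u₂ ≡ l * B w₁ w₂ ×
   k * B u₂ u₂ ≡ l * B w₂ w₂)

-- Index |Λ_h : L| = k : a complete system of k pairwise incongruent
-- representatives of ℤ² / L (i.e. of Λ_h / A M ℤ²).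
HasIndex : Lat → ℕ → Set
HasIndex L k = Σ (Fin k → V) λ r →
  (∀ z → ∃[ i ] ((z ⊖ r i) ∈L L)) ×
  (∀ i j → (r i ⊖ r j) ∈L L → i ≡ j)

PrimitiveEisenstein : ℕ → ℕ → ℕ → Set
PrimitiveEisenstein a b c =
  (+ a * + a - + a * + b + + b * + b ≡ + c * + c) ×
  ¬ (a ≡ 0 × b ≡ 0 × c ≡ 0) ×
  a ℕ.≤ b ×
  ℕG.gcd (ℕG.gcd a b) c ≡ 1

Admissible : ℤ → ℤ → Set
Admissible m n =
  + 0 < m × + 0 < n × ℤG.gcd m n ≡ + 1 ×
  n ≤ m × m ≤ + 2 * n × ¬ (+ 3 ∣ (m + n))

Parametrizes : ℤ → ℤ → ℤ → ℤ → ℤ → Set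
Parametrizes m n x y z =
  x ≡ m * (+ 2 * n - m) × y ≡ n * (+ 2 * m - n) × z ≡ m * m - m * n + n * n

Γθ : ℤ → ℤ → Lat
Γθ m n = lat (m , m - n) (m - n , m)

{-# OPTIONS --safe #-}
-- With g₁ = (m , m - n) and g₂ = (m - n , m) the generators of Γθ, the ring identity
--   2 (Q (x g₁ + y g₂) - Q (m , n))
--     = (2n - m)(m + n) (Q (x , y) - 1) + 3m(m - n) (Q (x , -y) - 1)
-- has a nonnegative right-hand side for (x , y) ≠ 0 when n ≤ m ≤ 2n, so g₁, g₂ (both of
-- norm c = Q (m , n)) form a minimal basis; their inner product 2m² - 2mn - n² is ±(b - 2a),
-- which gives the angle. Two lattices with minimal bases of the same angle have proportional
-- Gram matrices, hence are similar; conversely a similarity carries a minimal basis to a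
-- minimal basis with the same Gram ratio. The index is det Γθ = n(2m - n) = b: the second
-- coordinates m - n and m of the generators are coprime, so the vectors (i , 0), 0 ≤ i < b,
-- represent ℤ² / Γθ.
module Submission where

open import Defs
open import Data.Nat as ℕ using (ℕ; _∸_; suc; z≤n)
import Data.Nat.GCD as ℕG
import Data.Nat.Properties as ℕP
open import Data.Integer
  using (ℤ; +_; +[1+_]; -[1+_]; _+_; _-_; _*_; -_; ∣_∣; _≤_; _<_; +≤+; +<+;
         _/ℕ_; _%ℕ_; ≢-nonZero; positive; nonNegative)
open import Data.Integer.Properties
  using (≤-trans; ≤-reflexive; <-≤-trans; <⇒≤; <⇒≢; drop‿+≤+; +-injective; neg-injective;
         *-assoc; *-comm; +-identityʳ; *-zeroʳ; *-identityˡ; -1*i≡-i; neg-distribʳ-*; pos-*; i*j≡0⇒i≡0∨j≡0;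
         *-cancelˡ-≡; *-cancelʳ-≡; *-cancelˡ-≤-pos; *-monoˡ-≤-nonNeg; i≤i+j; i≤j+i; i-j≤i;
         i≤j⇒0≤j-i; 0≤i-j⇒j≤i; i-j≡0⇒i≡j; suc[i]≤j⇒i<j; +∣i∣≡i⊎+∣i∣≡-i; ∣-i∣≡∣i∣;
         m-n≡m⊖n; ⊖-≥)
import Data.Integer.GCD as ℤG
open import Data.Integer.DivMod using (a≡a%ℕn+[a/ℕn]*n; n%ℕd<d)
open import Data.Integer.Tactic.RingSolver using (solve; solve-∀)
open import Data.List using (_∷_; [])
open import Data.Fin using (Fin; toℕ; fromℕ<)
open import Data.Fin.Properties using (toℕ-injective; toℕ<n; toℕ-fromℕ<)
open import Data.Product using (∃-syntax; _×_; _,_; proj₁; proj₂)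
open import Data.Sum using (_⊎_; inj₁; inj₂; [_,_]′)
open import Data.Empty using (⊥-elim)
open import Function.Bundles using (_⇔_; mk⇔)
open import Relation.Binary.PropositionalEquality
open ≡-Reasoning

-- The ring solver does not unfold Q, B, detM or lincomb, so identities about them go through
-- coordinate-level `expand` lemmas; and integer _*_ unfolds during unification, so scalars
-- occurring only under _*_ are passed explicitly.

0≤i+j : ∀ {i j} → + 0 ≤ i → + 0 ≤ j → + 0 ≤ i + j
0≤i+j (+≤+ _) (+≤+ _) = +≤+ z≤n

0≤i*j : ∀ {i j} → + 0 ≤ i → + 0 ≤ j → + 0 ≤ i * j
0≤i*j {+ i} {+ j} _ _ = subst (+ 0 ≤_) (pos-* i j) (+≤+ z≤n)

3≤4*i⇒1≤i : ∀ i → + 3 ≤ + 4 * i → + 1 ≤ i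
3≤4*i⇒1≤i (+ 0) (+≤+ ())
3≤4*i⇒1≤i +[1+ _ ] _ = +≤+ (ℕ.s≤s z≤n)
3≤4*i⇒1≤i -[1+ _ ] ()

0≤i*i : ∀ i → + 0 ≤ i * i
0≤i*i (+ i) = 0≤i*j {+ i} {+ i} (+≤+ z≤n) (+≤+ z≤n)
0≤i*i -[1+ _ ] = +≤+ z≤n

1≤i*i : ∀ {i} → i ≢ + 0 → + 1 ≤ i * i
1≤i*i {+ 0} i≢0 = ⊥-elim (i≢0 refl)
1≤i*i {+[1+ _ ]} _ = +≤+ (ℕ.s≤s z≤n)
1≤i*i { -[1+ _ ]} _ = +≤+ (ℕ.s≤s z≤n)

2*i≢0 : ∀ {i} → + 0 < i → + 2 * i ≢ + 0
2*i≢0 {+ 0} (+<+ ())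
2*i≢0 {+[1+ _ ]} _ ()

≤-scaled : ∀ {k l x x' y y'} → + 0 < k → + 0 ≤ l →
  k * x ≡ l * x' → k * y ≡ l * y' → x' ≤ y' → x ≤ y
≤-scaled {k} {l} {x} {x'} {y} {y'} 0<k 0≤l kx≡lx' ky≡ly' x'≤y' =
  *-cancelˡ-≤-pos x y k {{positive 0<k}}
    (≤-trans (≤-reflexive kx≡lx')
      (≤-trans (*-monoˡ-≤-nonNeg l {{nonNegative 0≤l}} x'≤y') (≤-reflexive (sym ky≡ly'))))

scaled-halve : ∀ k l a a' → k * (+ 2 * a) ≡ l * (+ 2 * a') → k * a ≡ l * a'
scaled-halve k l a a' e = *-cancelˡ-≡ (+ 2) (k * a) (l * a') (begin
  + 2 * (k * a)   ≡⟨ solve (k ∷ a ∷ []) ⟩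
  k * (+ 2 * a)   ≡⟨ e ⟩
  l * (+ 2 * a')  ≡⟨ solve (l ∷ a' ∷ []) ⟩
  + 2 * (l * a')  ∎)

cross-multiply : ∀ {s} b b' q q' r → s ≢ + 0 →
  b * s ≡ + 2 * q * r → b' * s ≡ + 2 * q' * r → q' * b ≡ q * b'
cross-multiply {s} b b' q q' r s≢0 e e' =
  *-cancelʳ-≡ (q' * b) (q * b') s {{≢-nonZero s≢0}} (begin
    q' * b * s          ≡⟨ *-assoc q' b s ⟩
    q' * (b * s)        ≡⟨ cong (q' *_) e ⟩
    q' * (+ 2 * q * r)  ≡⟨ solve (q ∷ q' ∷ r ∷ []) ⟩
    q * (+ 2 * q' * r)  ≡⟨ cong (q *_) (sym e') ⟩
    q * (b' * s)        ≡⟨ *-assoc q b' s ⟨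
    q * b' * s          ∎)

ratio-scaled : ∀ {k} l b b' q q' r s → k ≢ + 0 →
  k * b ≡ l * b' → k * q ≡ l * q' → b' * s ≡ + 2 * q' * r → b * s ≡ + 2 * q * r
ratio-scaled {k} l b b' q q' r s k≢0 eb eq e =
  *-cancelˡ-≡ k (b * s) (+ 2 * q * r) {{≢-nonZero k≢0}} (begin
    k * (b * s)           ≡⟨ *-assoc k b s ⟨
    k * b * s             ≡⟨ cong (_* s) eb ⟩
    l * b' * s            ≡⟨ *-assoc l b' s ⟩
    l * (b' * s)          ≡⟨ cong (l *_) e ⟩
    l * (+ 2 * q' * r)    ≡⟨ solve (l ∷ q' ∷ r ∷ []) ⟩
    + 2 * (l * q') * r    ≡⟨ cong (λ t → + 2 * t * r) eq ⟨
    + 2 * (k * q) * r     ≡⟨ solve (k ∷ q ∷ r ∷ []) ⟩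
    k * (+ 2 * q * r)     ∎)

lincomb : ℤ → ℤ → V → V → V
lincomb x y u v = (x · u) ⊕ (y · v)

lincomb-lincomb : ∀ x y a b c d u v →
  lincomb x y (lincomb a b u v) (lincomb c d u v) ≡ lincomb (x * a + y * c) (x * b + y * d) u v
lincomb-lincomb x y a b c d (u₁ , u₂) (v₁ , v₂) = cong₂ _,_ (expand u₁ v₁) (expand u₂ v₂)
  where
  expand : ∀ s t → x * (a * s + b * t) + y * (c * s + d * t) ≡ (x * a + y * c) * s + (x * b + y * d) * t
  expand s t = solve (x ∷ y ∷ a ∷ b ∷ c ∷ d ∷ s ∷ t ∷ [])

lincomb-unitˡ : ∀ u v → lincomb (+ 1) (+ 0) u v ≡ u
lincomb-unitˡ (u₁ , u₂) (v₁ , v₂) = cong₂ _,_ (unit u₁ v₁) (unit u₂ v₂)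
  where
  unit : ∀ s t → + 1 * s + + 0 * t ≡ s
  unit = solve-∀

lincomb-unitʳ : ∀ u v → lincomb (+ 0) (+ 1) u v ≡ v
lincomb-unitʳ (u₁ , u₂) (v₁ , v₂) = cong₂ _,_ (unit u₁ v₁) (unit u₂ v₂)
  where
  unit : ∀ s t → + 0 * s + + 1 * t ≡ t
  unit = solve-∀

∈L-lincomb : ∀ {L u v} x y → u ∈L L → v ∈L L → lincomb x y u v ∈L L
∈L-lincomb {L} x y (a , b , refl) (c , d , refl) =
  x * a + y * c , x * b + y * d , lincomb-lincomb x y a b c d (p L) (q L)

∈L-⊆ : ∀ {L L' v} → p L ∈L L' → q L ∈L L' → v ∈L L → v ∈L L'
∈L-⊆ p∈L' q∈L' (i , j , refl) = ∈L-lincomb i j p∈L' q∈L'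

p∈L : ∀ L → p L ∈L L
p∈L L = + 1 , + 0 , sym (lincomb-unitˡ (p L) (q L))

q∈L : ∀ L → q L ∈L L
q∈L L = + 0 , + 1 , sym (lincomb-unitʳ (p L) (q L))

generators-basis : ∀ L → IsBasis L (p L) (q L)
generators-basis L = p∈L L , q∈L L , p∈L L , q∈L L

∈L-basis : ∀ {L u v w} → IsBasis L u v → w ∈L L → w ∈L lat u v
∈L-basis (_ , _ , p∈ , q∈) = ∈L-⊆ p∈ q∈

neg : V → V
neg v = (- + 1) · v

∈L-neg : ∀ {L v} → v ∈L L → neg v ∈L L
∈L-neg {lat (p₁ , p₂) (q₁ , q₂)} (i , j , refl) = - i , - j , cong₂ _,_ (expand p₁ q₁) (expand p₂ q₂)
  where
  expand : ∀ s t → - + 1 * (i * s + j * t) ≡ - i * s + - j * t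
  expand s t = solve (i ∷ j ∷ s ∷ t ∷ [])

∈lat-flip : ∀ {u v w} → w ∈L lat u v → w ∈L lat u (neg v)
∈lat-flip {u₁ , u₂} {v₁ , v₂} (i , j , refl) = i , - j , cong₂ _,_ (expand u₁ v₁) (expand u₂ v₂)
  where
  expand : ∀ s t → i * s + j * t ≡ i * s + - j * (- + 1 * t)
  expand s t = solve (i ∷ j ∷ s ∷ t ∷ [])

detM-lincomb : ∀ a b c d u v →
  detM (lat (lincomb a b u v) (lincomb c d u v)) ≡ detM (lat u v) * (a * d - c * b)
detM-lincomb a b c d (u₁ , u₂) (v₁ , v₂) = expand a b c d u₁ u₂ v₁ v₂
  where
  expand : ∀ a b c d u₁ u₂ v₁ v₂ →
    (a * u₁ + b * v₁) * (c * u₂ + d * v₂) - (c * u₁ + d * v₁) * (a * u₂ + b * v₂)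
      ≡ (u₁ * v₂ - v₁ * u₂) * (a * d - c * b)
  expand = solve-∀

detM-lincombˡ : ∀ x y u v → detM (lat (lincomb x y u v) v) ≡ x * detM (lat u v)
detM-lincombˡ x y (u₁ , u₂) (v₁ , v₂) = expand x y u₁ u₂ v₁ v₂
  where
  expand : ∀ x y u₁ u₂ v₁ v₂ → (x * u₁ + y * v₁) * v₂ - v₁ * (x * u₂ + y * v₂) ≡ x * (u₁ * v₂ - v₁ * u₂)
  expand = solve-∀

detM-lincombʳ : ∀ x y u v → detM (lat u (lincomb x y u v)) ≡ y * detM (lat u v)
detM-lincombʳ x y (u₁ , u₂) (v₁ , v₂) = expand x y u₁ u₂ v₁ v₂
  where
  expand : ∀ x y u₁ u₂ v₁ v₂ → u₁ * (x * u₂ + y * v₂) - (x * u₁ + y * v₁) * u₂ ≡ y * (u₁ * v₂ - v₁ * u₂)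
  expand = solve-∀

basis-independent : ∀ {L u v} → IsBasis L u v → FullRank L → detM (lat u v) ≢ + 0
basis-independent {L} {u} {v} (_ , _ , (a , b , p≡) , (c , d , q≡)) full D≡0 = full (begin
  detM L                                          ≡⟨ cong₂ (λ s t → detM (lat s t)) p≡ q≡ ⟩
  detM (lat (lincomb a b u v) (lincomb c d u v))  ≡⟨ detM-lincomb a b c d u v ⟩
  detM (lat u v) * (a * d - c * b)                ≡⟨ cong (_* (a * d - c * b)) D≡0 ⟩
  + 0                                             ∎)

lincomb-injective : ∀ {u v} x y x' y' → detM (lat u v) ≢ + 0 →
  lincomb x y u v ≡ lincomb x' y' u v → x ≡ x' × y ≡ y'
lincomb-injective {u} {v} x y x' y' D≢0 e =
  *-cancelʳ-≡ x x' D (begin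
    x * D                              ≡⟨ detM-lincombˡ x y u v ⟨
    detM (lat (lincomb x y u v) v)     ≡⟨ cong (λ w → detM (lat w v)) e ⟩
    detM (lat (lincomb x' y' u v) v)   ≡⟨ detM-lincombˡ x' y' u v ⟩
    x' * D                             ∎) ,
  *-cancelʳ-≡ y y' D (begin
    y * D                              ≡⟨ detM-lincombʳ x y u v ⟨
    detM (lat u (lincomb x y u v))     ≡⟨ cong (λ w → detM (lat u w)) e ⟩
    detM (lat u (lincomb x' y' u v))   ≡⟨ detM-lincombʳ x' y' u v ⟩
    y' * D                             ∎)
  where
  D = detM (lat u v)
  instance
    _ = ≢-nonZero D≢0

lincomb-nonzero : ∀ {u v x y} → detM (lat u v) ≢ + 0 → (x , y) ≢ zeroV → lincomb x y u v ≢ zeroV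
lincomb-nonzero {u} {v} {x} {y} D≢0 xy≢0 e =
  xy≢0 (let (x≡0 , y≡0) = lincomb-injective {u} {v} x y (+ 0) (+ 0) D≢0 e in cong₂ _,_ x≡0 y≡0)

-- 4 Q (x , y) = (2x - y)² + 3y² ≥ 3 when y ≠ 0.
Q-positive-y≢0 : ∀ x y → y ≢ + 0 → + 1 ≤ Q (x , y)
Q-positive-y≢0 x y y≢0 = 3≤4*i⇒1≤i (Q (x , y)) (subst (+ 3 ≤_) (sym (four-times x y))
  (≤-trans (*-monoˡ-≤-nonNeg (+ 3) (1≤i*i y≢0))
    (i≤j+i (+ 3 * (y * y)) ((+ 2 * x - y) * (+ 2 * x - y)) {{nonNegative (0≤i*i (+ 2 * x - y))}})))
  where
  four-times : ∀ x y → + 4 * (x * x - x * y + y * y) ≡ (+ 2 * x - y) * (+ 2 * x - y) + + 3 * (y * y)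
  four-times = solve-∀

Q-positive : ∀ v → v ≢ zeroV → + 1 ≤ Q v
Q-positive (x , + 0) v≢0 = subst (+ 1 ≤_) (sym (square x)) (1≤i*i (λ x≡0 → v≢0 (cong (_, + 0) x≡0)))
  where
  square : ∀ x → x * x - x * + 0 + + 0 * + 0 ≡ x * x
  square = solve-∀
Q-positive (x , y@(+[1+ _ ])) _ = Q-positive-y≢0 x y (λ ())
Q-positive (x , y@(-[1+ _ ])) _ = Q-positive-y≢0 x y (λ ())

Q-neg : ∀ v → Q (neg v) ≡ Q v
Q-neg (x , y) = expand x y
  where
  expand : ∀ x y → - + 1 * x * (- + 1 * x) - - + 1 * x * (- + 1 * y) + - + 1 * y * (- + 1 * y)
    ≡ x * x - x * y + y * y
  expand = solve-∀

B-neg : ∀ u v → B u (neg v) ≡ - B u v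
B-neg (x₁ , y₁) (x₂ , y₂) = expand x₁ y₁ x₂ y₂
  where
  expand : ∀ x₁ y₁ x₂ y₂ →
    + 2 * x₁ * (- + 1 * x₂) - x₁ * (- + 1 * y₂) - - + 1 * x₂ * y₁ + + 2 * y₁ * (- + 1 * y₂)
      ≡ - (+ 2 * x₁ * x₂ - x₁ * y₂ - x₂ * y₁ + + 2 * y₁ * y₂)
  expand = solve-∀

B-diagonal : ∀ v → B v v ≡ + 2 * Q v
B-diagonal (x , y) = expand x y
  where
  expand : ∀ x y → + 2 * x * x - x * y - x * y + + 2 * y * y ≡ + 2 * (x * x - x * y + y * y)
  expand = solve-∀

Q-lincomb : ∀ x y u v → Q (lincomb x y u v) ≡ x * x * Q u + x * y * B u v + y * y * Q v
Q-lincomb x y (u₁ , u₂) (v₁ , v₂) = expand x y u₁ u₂ v₁ v₂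
  where
  expand : ∀ x y u₁ u₂ v₁ v₂ →
    (x * u₁ + y * v₁) * (x * u₁ + y * v₁) - (x * u₁ + y * v₁) * (x * u₂ + y * v₂) + (x * u₂ + y * v₂) * (x * u₂ + y * v₂)
      ≡ x * x * (u₁ * u₁ - u₁ * u₂ + u₂ * u₂)
        + x * y * (+ 2 * u₁ * v₁ - u₁ * v₂ - v₁ * u₂ + + 2 * u₂ * v₂)
        + y * y * (v₁ * v₁ - v₁ * v₂ + v₂ * v₂)
  expand = solve-∀

B-lincomb : ∀ x y x' y' u v → B (lincomb x y u v) (lincomb x' y' u v)
  ≡ x * x' * B u u + (x * y' + y * x') * B u v + y * y' * B v v
B-lincomb x y x' y' (u₁ , u₂) (v₁ , v₂) = expand x y x' y' u₁ u₂ v₁ v₂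
  where
  expand : ∀ x y x' y' u₁ u₂ v₁ v₂ →
    + 2 * (x * u₁ + y * v₁) * (x' * u₁ + y' * v₁) - (x * u₁ + y * v₁) * (x' * u₂ + y' * v₂)
      - (x' * u₁ + y' * v₁) * (x * u₂ + y * v₂) + + 2 * (x * u₂ + y * v₂) * (x' * u₂ + y' * v₂)
      ≡ x * x' * (+ 2 * u₁ * u₁ - u₁ * u₂ - u₁ * u₂ + + 2 * u₂ * u₂)
        + (x * y' + y * x') * (+ 2 * u₁ * v₁ - u₁ * v₂ - v₁ * u₂ + + 2 * u₂ * v₂)
        + y * y' * (+ 2 * v₁ * v₁ - v₁ * v₂ - v₁ * v₂ + + 2 * v₂ * v₂)
  expand = solve-∀

-- Minimal bases and angles

minimum-positive : ∀ {L N} → IsMinimum L N → + 0 < N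
minimum-positive ((v , _ , v≢0 , refl) , _) = suc[i]≤j⇒i<j (Q-positive v v≢0)

minimalBasis-intro : ∀ {L u v} → IsBasis L u v → u ≢ zeroV → Q v ≡ Q u →
  (∀ x y → (x , y) ≢ zeroV → Q u ≤ Q (lincomb x y u v)) → MinimalBasis L u v
minimalBasis-intro {L} {u} {v} basis u≢0 Qv≡Qu short =
  basis , ((u , proj₁ basis , u≢0 , refl) , minimal) , Qv≡Qu
  where
  minimal : ∀ w → w ∈L L → w ≢ zeroV → Q u ≤ Q w
  minimal w w∈L w≢0 with ∈L-basis basis w∈L
  ... | x , y , refl = short x y (λ { refl → w≢0 refl })

minimalBasis-flip : ∀ {L u v} → MinimalBasis L u v → MinimalBasis L u (neg v)
minimalBasis-flip {v = v} ((u∈ , v∈ , p∈ , q∈) , minimum , Qv≡Qu) =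
  (u∈ , ∈L-neg v∈ , ∈lat-flip p∈ , ∈lat-flip q∈) , minimum , trans (Q-neg v) Qv≡Qu

-- u - ε v is a nonzero lattice vector of norm 2 Q u - ε B u v.
minimalBasis-B-bound : ∀ {L u v} → FullRank L → MinimalBasis L u v →
  ∀ ε → ε * ε ≡ + 1 → ε * B u v ≤ Q u
minimalBasis-B-bound {L} {u} {v} full (basis@(u∈ , v∈ , _) , (_ , minimal) , Qv≡Qu) ε ε²≡1 =
  0≤i-j⇒j≤i (subst (+ 0 ≤_) excess (i≤j⇒0≤j-i (minimal w (∈L-lincomb (+ 1) (- ε) u∈ v∈) w≢0)))
  where
  w = lincomb (+ 1) (- ε) u v
  w≢0 : w ≢ zeroV
  w≢0 = lincomb-nonzero {u} {v} {+ 1} { - ε} (basis-independent basis full) (λ ())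
  rearrange : ∀ a β e →
    + 1 * + 1 * a + + 1 * - e * β + - e * - e * a - a ≡ a - e * β + (e * e - + 1) * a
  rearrange = solve-∀
  excess : Q w - Q u ≡ Q u - ε * B u v
  excess = begin
    Q w - Q u                                       ≡⟨ cong (_- Q u) (Q-lincomb (+ 1) (- ε) u v) ⟩
    + 1 * + 1 * Q u + + 1 * - ε * B u v + - ε * - ε * Q v - Q u
                          ≡⟨ cong (λ c → + 1 * + 1 * Q u + + 1 * - ε * B u v + - ε * - ε * c - Q u) Qv≡Qu ⟩
    + 1 * + 1 * Q u + + 1 * - ε * B u v + - ε * - ε * Q u - Q u
                                                    ≡⟨ rearrange (Q u) (B u v) ε ⟩
    Q u - ε * B u v + (ε * ε - + 1) * Q u           ≡⟨ cong (λ t → Q u - ε * B u v + (t - + 1) * Q u) ε²≡1 ⟩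
    Q u - ε * B u v + + 0                           ≡⟨ +-identityʳ (Q u - ε * B u v) ⟩
    Q u - ε * B u v                                 ∎

angleCos-intro : ∀ {L u v} → MinimalBasis L u v → + 0 ≤ B u v → B u v ≤ Q u →
  AngleCos L (B u v) (+ 2 * Q u)
angleCos-intro {u = u} {v} mb 0≤B B≤Q = u , v , mb , 0≤B , B≤Q , *-comm (B u v) (+ 2 * Q u)

minimalBasis⇒angleCos : ∀ {L u v} → FullRank L → MinimalBasis L u v →
  AngleCos L (+ ∣ B u v ∣) (+ 2 * Q u)
minimalBasis⇒angleCos {L} {u} {v} full mb with +∣i∣≡i⊎+∣i∣≡-i (B u v)
... | inj₁ ∣B∣≡B = subst (λ r → AngleCos L r (+ 2 * Q u)) (sym ∣B∣≡B)
  (angleCos-intro {L} {u} {v} mb (subst (+ 0 ≤_) ∣B∣≡B (+≤+ z≤n))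
    (subst (_≤ Q u) (*-identityˡ (B u v)) (minimalBasis-B-bound {L} {u} {v} full mb (+ 1) refl)))
... | inj₂ ∣B∣≡-B = subst (λ r → AngleCos L r (+ 2 * Q u)) B′≡∣B∣
  (angleCos-intro {L} {u} {neg v} (minimalBasis-flip {L} {u} {v} mb)
    (subst (+ 0 ≤_) (sym B′≡∣B∣) (+≤+ z≤n))
    (subst (_≤ Q u) (trans (-1*i≡-i (B u v)) (sym (B-neg u v)))
      (minimalBasis-B-bound {L} {u} {v} full mb (- + 1) refl)))
  where
  B′≡∣B∣ : B u (neg v) ≡ + ∣ B u v ∣
  B′≡∣B∣ = trans (B-neg u v) (sym ∣B∣≡-B)

-- Similarity

Gram-diagonal : ∀ a b → Q b * B a a ≡ Q a * B b b
Gram-diagonal a b = begin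
  Q b * B a a          ≡⟨ cong (Q b *_) (B-diagonal a) ⟩
  Q b * (+ 2 * Q a)    ≡⟨ swap (Q a) (Q b) ⟩
  Q a * (+ 2 * Q b)    ≡⟨ cong (Q a *_) (B-diagonal b) ⟨
  Q a * B b b          ∎
  where
  swap : ∀ i j → j * (+ 2 * i) ≡ i * (+ 2 * j)
  swap = solve-∀

-- The minimal bases have Gram matrices proportional by the factor Q u / Q w.
angleCos⇒similar : ∀ {Ω Γ r s} → s ≢ + 0 → AngleCos Ω r s → AngleCos Γ r s → Similar Ω Γ
angleCos⇒similar {r = r} s≢0 (u , v , (basisΩ , minimumΩ , Qv≡Qu) , _ , _ , ratioΩ)
                        (w , z , (basisΓ , minimumΓ , Qz≡Qw) , _ , _ , ratioΓ) =
  u , v , w , z , Q w , Q u , basisΩ , basisΓ , minimum-positive minimumΓ , minimum-positive minimumΩ ,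
  Gram-diagonal u w , cross-multiply (B u v) (B w z) (Q u) (Q w) r s≢0 ratioΩ ratioΓ ,
  subst₂ (λ i j → i * B v v ≡ j * B z z) Qz≡Qw Qv≡Qu (Gram-diagonal v z)

module SimilarityTransport
  {Ω Γ : Lat} {u₁ u₂ w₁ w₂ : V} {k l : ℤ}
  (basisΩ : IsBasis Ω u₁ u₂) (basisΓ : IsBasis Γ w₁ w₂) (0<k : + 0 < k) (0<l : + 0 < l)
  (e₁₁ : k * B u₁ u₁ ≡ l * B w₁ w₁) (e₁₂ : k * B u₁ u₂ ≡ l * B w₁ w₂) (e₂₂ : k * B u₂ u₂ ≡ l * B w₂ w₂)
  (w-independent : detM (lat w₁ w₂) ≢ + 0)
  where

  -- ω and γ read coordinates in the bases of Ω and Γ; the similarity makes k Q ∘ ω = l Q ∘ γ.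
  ω γ : V → V
  ω (x , y) = lincomb x y u₁ u₂
  γ (x , y) = lincomb x y w₁ w₂

  k≢0 : k ≢ + 0
  k≢0 k≡0 = <⇒≢ 0<k (sym k≡0)

  B-scaled : ∀ c d → k * B (ω c) (ω d) ≡ l * B (γ c) (γ d)
  B-scaled (x , y) (x' , y') = begin
    k * B (ω (x , y)) (ω (x' , y'))
      ≡⟨ cong (k *_) (B-lincomb x y x' y' u₁ u₂) ⟩
    k * (X * B u₁ u₁ + Y * B u₁ u₂ + Z * B u₂ u₂)
      ≡⟨ distribute k X Y Z (B u₁ u₁) (B u₁ u₂) (B u₂ u₂) ⟩
    X * (k * B u₁ u₁) + Y * (k * B u₁ u₂) + Z * (k * B u₂ u₂)
      ≡⟨ cong₂ _+_ (cong₂ _+_ (cong (X *_) e₁₁) (cong (Y *_) e₁₂)) (cong (Z *_) e₂₂) ⟩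
    X * (l * B w₁ w₁) + Y * (l * B w₁ w₂) + Z * (l * B w₂ w₂)
      ≡⟨ distribute l X Y Z (B w₁ w₁) (B w₁ w₂) (B w₂ w₂) ⟨
    l * (X * B w₁ w₁ + Y * B w₁ w₂ + Z * B w₂ w₂)
      ≡⟨ cong (l *_) (B-lincomb x y x' y' w₁ w₂) ⟨
    l * B (γ (x , y)) (γ (x' , y'))  ∎
    where
    X = x * x'
    Y = x * y' + y * x'
    Z = y * y'
    distribute : ∀ k X Y Z a b c → k * (X * a + Y * b + Z * c) ≡ X * (k * a) + Y * (k * b) + Z * (k * c)
    distribute = solve-∀

  Q-scaled : ∀ c → k * Q (ω c) ≡ l * Q (γ c)
  Q-scaled c = scaled-halve k l (Q (ω c)) (Q (γ c))
    (trans (cong (k *_) (sym (B-diagonal (ω c)))) (trans (B-scaled c c) (cong (l *_) (B-diagonal (γ c)))))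

  ω∈Ω : ∀ c → ω c ∈L Ω
  ω∈Ω (x , y) = ∈L-lincomb x y (proj₁ basisΩ) (proj₁ (proj₂ basisΩ))

  γ∈Γ : ∀ c → γ c ∈L Γ
  γ∈Γ (x , y) = ∈L-lincomb x y (proj₁ basisΓ) (proj₁ (proj₂ basisΓ))

  ω-onto : ∀ {v} → v ∈L Ω → ∃[ c ] (v ≡ ω c)
  ω-onto v∈Ω = let (x , y , v≡) = ∈L-basis basisΩ v∈Ω in (x , y) , v≡

  γ-onto : ∀ {v} → v ∈L Γ → ∃[ c ] (v ≡ γ c)
  γ-onto v∈Γ = let (x , y , v≡) = ∈L-basis basisΓ v∈Γ in (x , y) , v≡

  γ-injective : ∀ c d → γ c ≡ γ d → c ≡ d
  γ-injective (x , y) (x' , y') e =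
    let (x≡ , y≡) = lincomb-injective {w₁} {w₂} x y x' y' w-independent e in cong₂ _,_ x≡ y≡

  ω-lat : ∀ c d e → γ e ∈L lat (γ c) (γ d) → ω e ∈L lat (ω c) (ω d)
  ω-lat c@(a , b) d@(a' , b') e (x , y , γe≡) = x , y , (begin
    ω e                       ≡⟨ cong ω (γ-injective e (lincomb x y c d)
                                   (trans γe≡ (lincomb-lincomb x y a b a' b' w₁ w₂))) ⟩
    ω (lincomb x y c d)       ≡⟨ lincomb-lincomb x y a b a' b' u₁ u₂ ⟨
    lincomb x y (ω c) (ω d)   ∎)

  γ-nonzero : ∀ e → ω e ≢ zeroV → γ e ≢ zeroV
  γ-nonzero e ωe≢0 γe≡0 = ωe≢0 (cong ω (γ-injective e (+ 0 , + 0) γe≡0))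

  basis-transport : ∀ c d → IsBasis Γ (γ c) (γ d) → IsBasis Ω (ω c) (ω d)
  basis-transport c d basis =
    ω∈Ω c , ω∈Ω d ,
    ∈L-⊆ u₁∈ u₂∈ (proj₁ (proj₂ (proj₂ basisΩ))) , ∈L-⊆ u₁∈ u₂∈ (proj₂ (proj₂ (proj₂ basisΩ)))
    where
    u₁∈ : u₁ ∈L lat (ω c) (ω d)
    u₁∈ = subst (_∈L lat (ω c) (ω d)) (lincomb-unitˡ u₁ u₂)
      (ω-lat c d (+ 1 , + 0) (subst (_∈L lat (γ c) (γ d)) (sym (lincomb-unitˡ w₁ w₂))
        (∈L-basis basis (proj₁ basisΓ))))
    u₂∈ : u₂ ∈L lat (ω c) (ω d)
    u₂∈ = subst (_∈L lat (ω c) (ω d)) (lincomb-unitʳ u₁ u₂)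
      (ω-lat c d (+ 0 , + 1) (subst (_∈L lat (γ c) (γ d)) (sym (lincomb-unitʳ w₁ w₂))
        (∈L-basis basis (proj₁ (proj₂ basisΓ)))))

  ω-nonzero : ∀ c → + 0 < Q (γ c) → ω c ≢ zeroV
  ω-nonzero c 0<Qγc ωc≡0 =
    [ (λ l≡0 → <⇒≢ 0<l (sym l≡0)) , (λ Qγc≡0 → <⇒≢ 0<Qγc (sym Qγc≡0)) ]′
      (i*j≡0⇒i≡0∨j≡0 l {Q (γ c)}
        (trans (sym (Q-scaled c)) (trans (cong (λ v → k * Q v) ωc≡0) (*-zeroʳ k))))

  minimal-transport : ∀ c → (∀ v → v ∈L Γ → v ≢ zeroV → Q (γ c) ≤ Q v) →
    ∀ v → v ∈L Ω → v ≢ zeroV → Q (ω c) ≤ Q v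
  minimal-transport c minimalΓ v v∈Ω v≢0 =
    let (e , v≡ωe) = ω-onto v∈Ω
    in subst (λ w → Q (ω c) ≤ Q w) (sym v≡ωe)
         (≤-scaled {x = Q (ω c)} {Q (γ c)} {Q (ω e)} {Q (γ e)} 0<k (<⇒≤ 0<l) (Q-scaled c) (Q-scaled e)
           (minimalΓ (γ e) (γ∈Γ e) (γ-nonzero e (λ ωe≡0 → v≢0 (trans v≡ωe ωe≡0)))))

  minimalBasis-transport : ∀ c d → MinimalBasis Γ (γ c) (γ d) → MinimalBasis Ω (ω c) (ω d)
  minimalBasis-transport c d (basis , minimumΓ@(_ , minimalΓ) , Qd≡Qc) =
    basis-transport c d basis ,
    ((ω c , ω∈Ω c , ω-nonzero c (minimum-positive minimumΓ) , refl) , minimal-transport c minimalΓ) ,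
    *-cancelˡ-≡ k (Q (ω d)) (Q (ω c)) {{≢-nonZero k≢0}}
      (trans (Q-scaled d) (trans (cong (l *_) Qd≡Qc) (sym (Q-scaled c))))

  angleCos-transport-basis : ∀ {r s G₁ G₂} c d → G₁ ≡ γ c → G₂ ≡ γ d → MinimalBasis Γ G₁ G₂ →
    + 0 ≤ B G₁ G₂ → B G₁ G₂ ≤ Q G₁ → B G₁ G₂ * s ≡ + 2 * Q G₁ * r → AngleCos Ω r s
  angleCos-transport-basis {r} {s} c d refl refl mb 0≤B B≤Q ratio =
    ω c , ω d , minimalBasis-transport c d mb ,
    ≤-scaled {x = + 0} {+ 0} {B (ω c) (ω d)} {B (γ c) (γ d)}
      0<k (<⇒≤ 0<l) (trans (*-zeroʳ k) (sym (*-zeroʳ l))) (B-scaled c d) 0≤B ,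
    ≤-scaled {x = B (ω c) (ω d)} {B (γ c) (γ d)} {Q (ω c)} {Q (γ c)}
      0<k (<⇒≤ 0<l) (B-scaled c d) (Q-scaled c) B≤Q ,
    ratio-scaled l (B (ω c) (ω d)) (B (γ c) (γ d)) (Q (ω c)) (Q (γ c)) r s k≢0
      (B-scaled c d) (Q-scaled c) ratio

  angleCos-transport : ∀ {r s} → AngleCos Γ r s → AngleCos Ω r s
  angleCos-transport (G₁ , G₂ , mb@((G₁∈Γ , G₂∈Γ , _) , _) , 0≤B , B≤Q , ratio) =
    let (c , G₁≡γc) = γ-onto G₁∈Γ
        (d , G₂≡γd) = γ-onto G₂∈Γ
    in angleCos-transport-basis c d G₁≡γc G₂≡γd mb 0≤B B≤Q ratio

similar⇒angleCos : ∀ {Ω Γ r s} → Similar Ω Γ → FullRank Γ → AngleCos Γ r s → AngleCos Ω r s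
similar⇒angleCos {Ω} {Γ} (u₁ , u₂ , w₁ , w₂ , k , l , basisΩ , basisΓ , 0<k , 0<l , e₁₁ , e₁₂ , e₂₂) full =
  angleCos-transport
  where
  open SimilarityTransport {Ω} {Γ} {u₁} {u₂} {w₁} {w₂} {k} {l} basisΩ basisΓ 0<k 0<l e₁₁ e₁₂ e₂₂
         (basis-independent {Γ} {w₁} {w₂} basisΓ full)

angleCos⇔similar : ∀ {Γ r s} → FullRank Γ → AngleCos Γ r s → s ≢ + 0 →
  ∀ Ω → (WellRounded Ω × AngleCos Ω r s) ⇔ (WellRounded Ω × Similar Ω Γ)
angleCos⇔similar {Γ} full angle s≢0 Ω =
  mk⇔ (λ (wr , θ) → wr , angleCos⇒similar {Ω} {Γ} s≢0 θ angle)
      (λ (wr , sim) → wr , similar⇒angleCos {Ω} {Γ} sim full angle)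

-- The lattice Γθ

Γθ-detM : ∀ m n → detM (Γθ m n) ≡ n * (+ 2 * m - n)
Γθ-detM = expand
  where
  expand : ∀ m n → m * m - (m - n) * (m - n) ≡ n * (+ 2 * m - n)
  expand = solve-∀

Γθ-Q-p : ∀ m n → Q (p (Γθ m n)) ≡ Q (m , n)
Γθ-Q-p = expand
  where
  expand : ∀ m n → m * m - m * (m - n) + (m - n) * (m - n) ≡ m * m - m * n + n * n
  expand = solve-∀

Γθ-Q-q : ∀ m n → Q (q (Γθ m n)) ≡ Q (m , n)
Γθ-Q-q = expand
  where
  expand : ∀ m n → (m - n) * (m - n) - (m - n) * m + m * m ≡ m * m - m * n + n * n
  expand = solve-∀

Γθ-norm-excess : ∀ m n x y →
  + 2 * (Q (lincomb x y (p (Γθ m n)) (q (Γθ m n))) - Q (m , n))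
    ≡ (+ 2 * n - m) * (m + n) * (Q (x , y) - + 1) + + 3 * m * (m - n) * (Q (x , - y) - + 1)
Γθ-norm-excess = expand
  where
  expand : ∀ m n x y →
    + 2 * ((x * m + y * (m - n)) * (x * m + y * (m - n)) - (x * m + y * (m - n)) * (x * (m - n) + y * m)
           + (x * (m - n) + y * m) * (x * (m - n) + y * m) - (m * m - m * n + n * n))
      ≡ (+ 2 * n - m) * (m + n) * (x * x - x * y + y * y - + 1)
        + + 3 * m * (m - n) * (x * x - x * - y + - y * - y - + 1)
  expand = solve-∀

Γθ-minimum-bound : ∀ {m n} → + 0 ≤ n → n ≤ m → m ≤ + 2 * n →
  ∀ x y → (x , y) ≢ zeroV → Q (m , n) ≤ Q (lincomb x y (p (Γθ m n)) (q (Γθ m n)))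
Γθ-minimum-bound {m} {n} 0≤n n≤m m≤2n x y xy≢0 =
  0≤i-j⇒j≤i {Q v} {Q (m , n)} (*-cancelˡ-≤-pos (+ 0) (Q v - Q (m , n)) (+ 2)
    (subst (+ 0 ≤_) (sym (Γθ-norm-excess m n x y)) excess≥0))
  where
  v = lincomb x y (p (Γθ m n)) (q (Γθ m n))
  0≤m = ≤-trans 0≤n n≤m
  x-y≢0 : (x , - y) ≢ zeroV
  x-y≢0 e = xy≢0 (cong₂ _,_ (cong proj₁ e) (neg-injective (cong proj₂ e)))
  excess≥0 : + 0 ≤ (+ 2 * n - m) * (m + n) * (Q (x , y) - + 1) + + 3 * m * (m - n) * (Q (x , - y) - + 1)
  excess≥0 = 0≤i+j
    (0≤i*j (0≤i*j (i≤j⇒0≤j-i m≤2n) (0≤i+j 0≤m 0≤n)) (i≤j⇒0≤j-i (Q-positive (x , y) xy≢0)))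
    (0≤i*j (0≤i*j (0≤i*j {+ 3} (+≤+ z≤n) 0≤m) (i≤j⇒0≤j-i n≤m)) (i≤j⇒0≤j-i (Q-positive (x , - y) x-y≢0)))

Γθ-fullRank : ∀ {m n} → + 0 < n → n ≤ m → FullRank (Γθ m n)
Γθ-fullRank {m} {n} 0<n n≤m det≡0 with i*j≡0⇒i≡0∨j≡0 n (trans (sym (Γθ-detM m n)) det≡0)
... | inj₁ n≡0 = <⇒≢ 0<n (sym n≡0)
... | inj₂ 2m-n≡0 = <⇒≢ 0<2m-n (sym 2m-n≡0)
  where
  split : ∀ m n → m + (m - n) ≡ + 2 * m - n
  split = solve-∀
  0<2m-n : + 0 < + 2 * m - n
  0<2m-n = <-≤-trans 0<n (≤-trans n≤m
    (subst (m ≤_) (split m n) (i≤i+j m (m - n) {{nonNegative (i≤j⇒0≤j-i n≤m)}})))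

Γθ-minimalBasis : ∀ {m n} → + 0 < n → n ≤ m → m ≤ + 2 * n →
  MinimalBasis (Γθ m n) (p (Γθ m n)) (q (Γθ m n))
Γθ-minimalBasis {m} {n} 0<n n≤m m≤2n =
  minimalBasis-intro (generators-basis (Γθ m n)) p≢0 (trans (Γθ-Q-q m n) (sym (Γθ-Q-p m n)))
    (λ x y xy≢0 → subst (_≤ Q (lincomb x y (p (Γθ m n)) (q (Γθ m n)))) (sym (Γθ-Q-p m n)) (Γθ-minimum-bound (<⇒≤ 0<n) n≤m m≤2n x y xy≢0))
  where
  p≢0 : p (Γθ m n) ≢ zeroV
  p≢0 e = <⇒≢ (<-≤-trans 0<n n≤m) (sym (cong proj₁ e))

∣b-2a∣≡∣B∣ : ∀ {a b c} m n → a ℕ.≤ b →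
  Parametrizes m n (+ a) (+ b) (+ c) ⊎ Parametrizes m n (+ (b ∸ a)) (+ b) (+ c) →
  ∣ + b - + 2 * + a ∣ ≡ ∣ B (p (Γθ m n)) (q (Γθ m n)) ∣
∣b-2a∣≡∣B∣ {a} {b} m n _ (inj₁ (a≡ , b≡ , _)) = cong ∣_∣ (begin
  + b - + 2 * + a                                ≡⟨ cong₂ (λ β α → β - + 2 * α) b≡ a≡ ⟩
  n * (+ 2 * m - n) - + 2 * (m * (+ 2 * n - m))  ≡⟨ expand m n ⟩
  B (p (Γθ m n)) (q (Γθ m n))                    ∎)
  where
  expand : ∀ m n → n * (+ 2 * m - n) - + 2 * (m * (+ 2 * n - m))
    ≡ + 2 * m * (m - n) - m * m - (m - n) * (m - n) + + 2 * (m - n) * m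
  expand = solve-∀
∣b-2a∣≡∣B∣ {a} {b} m n a≤b (inj₂ (a′≡ , b≡ , _)) = begin
  ∣ + b - + 2 * + a ∣                                   ≡⟨ cong ∣_∣ (reflect (+ a) (+ b)) ⟩
  ∣ + 2 * (+ b - + a) - + b ∣                           ≡⟨ cong (λ α → ∣ + 2 * α - + b ∣) (trans b-a≡ a′≡) ⟩
  ∣ + 2 * (m * (+ 2 * n - m)) - + b ∣                   ≡⟨ cong (λ β → ∣ + 2 * (m * (+ 2 * n - m)) - β ∣) b≡ ⟩
  ∣ + 2 * (m * (+ 2 * n - m)) - n * (+ 2 * m - n) ∣     ≡⟨ cong ∣_∣ (expand m n) ⟩
  ∣ - B (p (Γθ m n)) (q (Γθ m n)) ∣                     ≡⟨ ∣-i∣≡∣i∣ (B (p (Γθ m n)) (q (Γθ m n))) ⟩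
  ∣ B (p (Γθ m n)) (q (Γθ m n)) ∣                       ∎
  where
  reflect : ∀ α β → β - + 2 * α ≡ + 2 * (β - α) - β
  reflect = solve-∀
  b-a≡ : + b - + a ≡ + (b ∸ a)
  b-a≡ = trans (m-n≡m⊖n b a) (⊖-≥ a≤b)
  expand : ∀ m n → + 2 * (m * (+ 2 * n - m)) - n * (+ 2 * m - n)
    ≡ - (+ 2 * m * (m - n) - m * m - (m - n) * (m - n) + + 2 * (m - n) * m)
  expand = solve-∀

-- Bézout's identity and the index

∣i∣-multiple : ∀ i → ∃[ ε ] (+ ∣ i ∣ ≡ ε * i)
∣i∣-multiple i with +∣i∣≡i⊎+∣i∣≡-i i
... | inj₁ ∣i∣≡i = + 1 , trans ∣i∣≡i (sym (*-identityˡ i))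
... | inj₂ ∣i∣≡-i = - + 1 , trans ∣i∣≡-i (sym (-1*i≡-i i))

Bézout-equation-ℤ : ∀ {x y M N} → 1 ℕ.+ y ℕ.* N ≡ x ℕ.* M → + 1 + + y * + N ≡ + x * + M
Bézout-equation-ℤ {x} {y} {M} {N} eq = trans (cong (λ k → + 1 + k) (sym (pos-* y N))) (trans (cong +_ eq) (pos-* x M))

bezout-ℕ : ∀ {M N} → ℕG.Bézout.Identity 1 M N → ∃[ s ] ∃[ t ] (s * + M + t * + N ≡ + 1)
bezout-ℕ {M} {N} (ℕG.Bézout.+- x y eq) = + x , - + y , (begin
  + x * + M + - + y * + N           ≡⟨ cong (_+ - + y * + N) (Bézout-equation-ℤ {x} {y} {M} {N} eq) ⟨
  + 1 + + y * + N + - + y * + N     ≡⟨ cancel (+ y) (+ N) ⟩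
  + 1                               ∎)
  where
  cancel : ∀ Y Z → + 1 + Y * Z + - Y * Z ≡ + 1
  cancel = solve-∀
bezout-ℕ {M} {N} (ℕG.Bézout.-+ x y eq) = - + x , + y , (begin
  - + x * + M + + y * + N           ≡⟨ cong (λ k → - + x * + M + k) (Bézout-equation-ℤ {y} {x} {N} {M} eq) ⟨
  - + x * + M + (+ 1 + + x * + M)   ≡⟨ cancel (+ x) (+ M) ⟩
  + 1                               ∎)
  where
  cancel : ∀ X Z → - X * Z + (+ 1 + X * Z) ≡ + 1
  cancel = solve-∀

bezout : ∀ i j → ℤG.gcd i j ≡ + 1 → ∃[ s ] ∃[ t ] (s * i + t * j ≡ + 1)
bezout i j gcd≡1 =
  let (s , t , e) = bezout-ℕ (subst (λ d → ℕG.Bézout.Identity d ∣ i ∣ ∣ j ∣) (+-injective gcd≡1)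
                               (ℕG.Bézout.identity (ℕG.gcd-GCD ∣ i ∣ ∣ j ∣)))
      (ε , ∣i∣≡εi) = ∣i∣-multiple i
      (δ , ∣j∣≡δj) = ∣i∣-multiple j
  in s * ε , t * δ , (begin
    s * ε * i + t * δ * j          ≡⟨ cong₂ _+_ (*-assoc s ε i) (*-assoc t δ j) ⟩
    s * (ε * i) + t * (δ * j)      ≡⟨ cong₂ (λ α β → s * α + t * β) ∣i∣≡εi ∣j∣≡δj ⟨
    s * + ∣ i ∣ + t * + ∣ j ∣      ≡⟨ e ⟩
    + 1                            ∎)

multiple-below : ∀ {i j b} w → i ℕ.< b → + i - + j ≢ + b * +[1+ w ]
multiple-below {i} {j} {b} w i<b e = ℕP.<⇒≱ i<b (drop‿+≤+
  (≤-trans (subst (+ b ≤_) (pos-* b (suc w)) (+≤+ (ℕP.m≤m*n b (suc w))))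
    (≤-trans (≤-reflexive (sym e)) (i-j≤i (+ i) (+ j)))))

residues-unique : ∀ {i j b} W → i ℕ.< b → j ℕ.< b → + i - + j ≡ + b * W → i ≡ j
residues-unique {i} {j} {b} (+ 0) _ _ e = +-injective (i-j≡0⇒i≡j (+ i) (+ j) (trans e (*-zeroʳ (+ b))))
residues-unique {j = j} +[1+ w ] i<b _ e = ⊥-elim (multiple-below {j = j} w i<b e)
residues-unique {i} {j} {b} -[1+ w ] _ j<b e = ⊥-elim (multiple-below {j = i} w j<b (begin
  + j - + i               ≡⟨ swap (+ i) (+ j) ⟩
  - (+ i - + j)           ≡⟨ cong -_ e ⟩
  - (+ b * -[1+ w ])      ≡⟨ neg-distribʳ-* (+ b) -[1+ w ] ⟩
  + b * +[1+ w ]          ∎))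
  where
  swap : ∀ α β → β - α ≡ - (α - β)
  swap = solve-∀

-- Reduce the first coordinate modulo b using (b , 0) = q₂ p - p₂ q, after clearing
-- the second one with the vector (σ , 1) = s p + t q.
hasIndex-detM : ∀ {p₁ p₂ q₁ q₂ s t} b .{{_ : ℕ.NonZero b}} →
  detM (lat (p₁ , p₂) (q₁ , q₂)) ≡ + b → s * p₂ + t * q₂ ≡ + 1 →
  HasIndex (lat (p₁ , p₂) (q₁ , q₂)) b
hasIndex-detM {p₁} {p₂} {q₁} {q₂} {s} {t} b det≡b bezout≡1 = representative , cover , distinct
  where
  L = lat (p₁ , p₂) (q₁ , q₂)
  σ = s * p₁ + t * q₁

  representative : Fin b → V
  representative i = (+ toℕ i , + 0)

  b-axis∈L : (+ b , + 0) ∈L L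
  b-axis∈L = q₂ , - p₂ , cong₂ _,_ (trans (sym det≡b) (expand₁ p₁ p₂ q₁ q₂)) (expand₂ p₂ q₂)
    where
    expand₁ : ∀ p₁ p₂ q₁ q₂ → p₁ * q₂ - q₁ * p₂ ≡ q₂ * p₁ + - p₂ * q₁
    expand₁ = solve-∀
    expand₂ : ∀ p₂ q₂ → + 0 ≡ q₂ * p₂ + - p₂ * q₂
    expand₂ = solve-∀

  σ-row∈L : (σ , + 1) ∈L L
  σ-row∈L = s , t , cong₂ _,_ refl (sym bezout≡1)

  cover : ∀ z → ∃[ i ] ((z ⊖ representative i) ∈L L)
  cover (x , y) = fromℕ< (n%ℕd<d N b) ,
    subst (λ ρ → ((x , y) ⊖ (+ ρ , + 0)) ∈L L) (sym (toℕ-fromℕ< (n%ℕd<d N b)))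
      (subst (_∈L L) (sym (cong₂ _,_ first second)) (∈L-lincomb k y b-axis∈L σ-row∈L))
    where
    N = x - y * σ
    k = N /ℕ b
    ρ = N %ℕ b
    first : x - + ρ ≡ k * + b + y * σ
    first = begin
      x - + ρ                       ≡⟨ shift x (y * σ) (+ ρ) ⟩
      N - + ρ + y * σ               ≡⟨ cong (λ ν → ν - + ρ + y * σ) (a≡a%ℕn+[a/ℕn]*n N b) ⟩
      + ρ + k * + b - + ρ + y * σ   ≡⟨ cancel (+ ρ) (k * + b) (y * σ) ⟩
      k * + b + y * σ               ∎
      where
      shift : ∀ x Y R → x - R ≡ x - Y - R + Y
      shift = solve-∀
      cancel : ∀ R K Y → R + K - R + Y ≡ K + Y
      cancel = solve-∀
    second : y - + 0 ≡ k * + 0 + y * + 1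
    second = expand k y
      where
      expand : ∀ k y → y - + 0 ≡ k * + 0 + y * + 1
      expand = solve-∀

  distinct : ∀ i j → (representative i ⊖ representative j) ∈L L → i ≡ j
  distinct i j (X , Y , e) = toℕ-injective (residues-unique (t * X - s * Y) (toℕ<n i) (toℕ<n j) (begin
    + toℕ i - + toℕ j
      ≡⟨ cong proj₁ e ⟩
    X * p₁ + Y * q₁
      ≡⟨ expand p₁ p₂ q₁ q₂ s t X Y ⟩
    (p₁ * q₂ - q₁ * p₂) * (t * X - s * Y) + σ * (X * p₂ + Y * q₂) + (X * p₁ + Y * q₁) * (+ 1 - (s * p₂ + t * q₂))
      ≡⟨ cong₂ (λ D β → D * (t * X - s * Y) + σ * β + (X * p₁ + Y * q₁) * (+ 1 - (s * p₂ + t * q₂)))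
           det≡b (sym (cong proj₂ e)) ⟩
    + b * (t * X - s * Y) + σ * + 0 + (X * p₁ + Y * q₁) * (+ 1 - (s * p₂ + t * q₂))
      ≡⟨ cong (λ β → + b * (t * X - s * Y) + σ * + 0 + (X * p₁ + Y * q₁) * (+ 1 - β)) bezout≡1 ⟩
    + b * (t * X - s * Y) + σ * + 0 + (X * p₁ + Y * q₁) * + 0
      ≡⟨ vanish (+ b * (t * X - s * Y)) σ (X * p₁ + Y * q₁) ⟩
    + b * (t * X - s * Y)  ∎))
    where
    expand : ∀ p₁ p₂ q₁ q₂ s t X Y → X * p₁ + Y * q₁
      ≡ (p₁ * q₂ - q₁ * p₂) * (t * X - s * Y) + (s * p₁ + t * q₁) * (X * p₂ + Y * q₂)
        + (X * p₁ + Y * q₁) * (+ 1 - (s * p₂ + t * q₂))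
    expand = solve-∀
    vanish : ∀ A B C → A + B * + 0 + C * + 0 ≡ A
    vanish = solve-∀

Γθ-hasIndex : ∀ {m n b} → FullRank (Γθ m n) → ℤG.gcd m n ≡ + 1 → detM (Γθ m n) ≡ + b →
  HasIndex (Γθ m n) b
Γθ-hasIndex {m} {n} {b} full gcd≡1 det≡b =
  let (σ , τ , e) = bezout m n gcd≡1
  in hasIndex-detM {m} {m - n} {m - n} {m} { - τ} {σ + τ} b det≡b (trans (columns σ τ m n) e)
  where
  instance
    _ = ℕ.≢-nonZero (λ b≡0 → full (trans det≡b (cong +_ b≡0)))
  columns : ∀ σ τ m n → - τ * (m - n) + (σ + τ) * m ≡ σ * m + τ * n
  columns = solve-∀

lemma4p7 : (a b c : ℕ) (m n : ℤ) →
    PrimitiveEisenstein a b c →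
    Admissible m n →
    (Parametrizes m n (+ a) (+ b) (+ c) ⊎ Parametrizes m n (+ (b ∸ a)) (+ b) (+ c)) →
    FullRank (Γθ m n) ×
    WellRounded (Γθ m n) ×
    AngleCos (Γθ m n) (+ ∣ + b - + 2 * + a ∣) (+ 2 * + c) ×
    (∀ (Ω : Lat) → FullRank Ω →
      ((WellRounded Ω × AngleCos Ω (+ ∣ + b - + 2 * + a ∣) (+ 2 * + c))
        ⇔ (WellRounded Ω × Similar Ω (Γθ m n)))) ×
    IsMinimum (Γθ m n) (+ c) ×
    ∣ detM (Γθ m n) ∣ ≡ b ×
    HasIndex (Γθ m n) b
lemma4p7 a b c m n (_ , _ , a≤b , _) (_ , 0<n , gcd≡1 , n≤m , m≤2n , _) param =
  full , (p Γ , q Γ , minimal) , angle ,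
  (λ Ω _ → angleCos⇔similar full angle (2*i≢0 (minimum-positive minimum)) Ω) ,
  minimum , cong ∣_∣ det≡b , Γθ-hasIndex full gcd≡1 det≡b
  where
  Γ = Γθ m n
  full = Γθ-fullRank 0<n n≤m
  minimal = Γθ-minimalBasis 0<n n≤m m≤2n
  det≡b : detM Γ ≡ + b
  det≡b = trans (Γθ-detM m n) (sym (proj₁ ([ proj₂ , proj₂ ]′ param)))
  Qp≡c : Q (p Γ) ≡ + c
  Qp≡c = trans (Γθ-Q-p m n) (sym (proj₂ ([ proj₂ , proj₂ ]′ param)))
  minimum : IsMinimum Γ (+ c)
  minimum = subst (IsMinimum Γ) Qp≡c (proj₁ (proj₂ minimal))
  angle : AngleCos Γ (+ ∣ + b - + 2 * + a ∣) (+ 2 * + c)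
  angle = subst₂ (AngleCos Γ) (cong +_ (sym (∣b-2a∣≡∣B∣ m n a≤b param))) (cong (+ 2 *_) Qp≡c)
    (minimalBasis⇒angleCos {Γ} {p Γ} {q Γ} full minimal)
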